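{- $e_{max}(7,7)=4/3$.
   Context: A 2-dimensional binary word of dimensions $h\times w$ is an $h\times w$ matrix $W$ with entries in $\{\square,\blacksquare\}$ (filled cells $\blacksquare$, empty cells $\square$); $|W|_\blacksquare$ is its number of filled cells. Positions $(i,j),(i',j')$ are adjacent if $|i-i'|+|j-j'|=1$; the degree of a filled cell is the number of filled cells adjacent to it. $\mathcal W^2_{h\times w}$ is the set of $h\times w$ words in which every filled cell has degree at most $2$. The excess of an $h\times w$ word is $e(W)=|W|_\blacksquare-2hw/3$ and $e_{max}(h,w)=\max\{e(W):W\in\mathcal W^2_{h\times w}\}$. -}

module Defs where

open import Data.Bool using (Bool; true; false; _∧_; if_then_else_)
open import Data.Nat using (ℕ; _+_; _*_; _≤_; ∣_-_∣; _≡ᵇ_)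
open import Data.Fin using (Fin; toℕ)
open import Data.List using (List; map; allFin)
open import Data.Nat.ListAction using (sum)
open import Data.Integer using (+_)
open import Data.Rational using (ℚ; _/_; _-_) renaming (_≤_ to _≤ℚ_)
open import Data.Product using (Σ; _×_)
open import Relation.Binary.PropositionalEquality using (_≡_)

-- A 2-dimensional binary word of dimensions h × w.
-- true = filled cell (■), false = empty cell (□).
Word : ℕ → ℕ → Set
Word h w = Fin h → Fin w → Bool

countCells : ∀ {h w} → (Fin h → Fin w → Bool) → ℕ
countCells {h} {w} P =
  sum (map (λ i → sum (map (λ j → if P i j then 1 else 0) (allFin w))) (allFin h))

filledCount : ∀ {h w} → Word h w → ℕ
filledCount W = countCells W

adjacent : ∀ {h w} → Fin h → Fin w → Fin h → Fin w → Bool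
adjacent i j i' j' = (∣ toℕ i - toℕ i' ∣ + ∣ toℕ j - toℕ j' ∣) ≡ᵇ 1

degree : ∀ {h w} → Word h w → Fin h → Fin w → ℕ
degree W i j = countCells (λ i' j' → W i' j' ∧ adjacent i j i' j')

InW2 : ∀ {h w} → Word h w → Set
InW2 W = ∀ i j → W i j ≡ true → degree W i j ≤ 2

excess : ∀ {h w} → Word h w → ℚ
excess {h} {w} W = (+ filledCount W / 1) - (+ (2 * h * w) / 3)

EmaxIs : ℕ → ℕ → ℚ → Set
EmaxIs h w q =
  (Σ (Word h w) λ W → InW2 W × excess W ≡ q)
  × (∀ (W : Word h w) → InW2 W → excess W ≤ℚ q)

{-# OPTIONS --safe #-}
module Submission where

-- A filled cell with three filled neighbours has degree at least 3, so a word of 𝒲² fills no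
-- claw (a cell together with three of its neighbours). Reading the 7 × 7 cells in row-major
-- order, a branch-and-bound search shows, for k = 48, 47, …, 0 in turn, that a claw-free filling
-- of the cells k, …, 48 has at most b_k filled cells, pruning with the bounds already shown;
-- b_0 = 34. The word below fills 34 cells with all degrees at most 2, and 34 − 2·49/3 = 4/3.

open import Defs
open import Data.Integer using (+_)
open import Data.Rational using (_/_)

open import Data.Bool using (Bool; true; false; T; _∧_; _∨_; if_then_else_)
open import Data.Bool.ListAction using (all; any)
open import Data.Bool.Properties as Bool using (T-∧; T-∨; T-≡)
open import Data.Empty using (⊥-elim)
open import Data.Fin using (Fin)
open import Data.Fin.Properties as Fin using (all?)
import Data.Integer as ℤ
import Data.Integer.Properties as ℤ
open import Data.List using (List; []; _∷_; [_]; _++_; map; concat; concatMap; filter; upTo; allFin)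
import Data.List.Membership.DecPropositional as DecMembership
open import Data.List.Relation.Unary.All as All using (All; []; _∷_)
open import Data.List.Relation.Unary.All.Properties using (all⁺; map⁺)
open import Data.List.Relation.Unary.Any as Any using (Any)
open import Data.List.Relation.Unary.Any.Properties using (any⁻)
open import Data.Nat using (ℕ; zero; suc; _+_; _*_; _∸_; _≤_; z≤n; s≤s; _≤ᵇ_; _<ᵇ_; NonZero)
import Data.Nat.Coprimality as Coprimality
open import Data.Nat.DivMod using (_%_; _mod_) renaming (_/_ to _div_)
open import Data.Nat.ListAction using (sum)
open import Data.Nat.ListAction.Properties using (sum-++)
open import Data.Nat.Properties as ℕ using (≤-trans; +-mono-≤; ≤ᵇ⇒≤)
open import Data.Product using (_×_; _,_; proj₁; proj₂; uncurry)
open import Data.Product.Properties using (≡-dec)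
open import Data.Rational using (_-_; -_; *≤*) renaming (_≤_ to _≤ℚ_)
import Data.Rational.Properties as ℚ
open import Data.Sum using (inj₁; inj₂)
open import Data.Vec as Vec using (Vec; []; _∷_)
open import Function using (_∘_)
open import Function.Bundles using (Equivalence)
open import Relation.Binary.Definitions using (DecidableEquality)
open import Relation.Binary.PropositionalEquality using (_≡_; refl; sym; cong; subst; subst₂; module ≡-Reasoning)
open import Relation.Nullary using (¬_; Dec)
open import Relation.Nullary.Decidable using (isYes; toWitness; _→-dec_)
open import Relation.Unary using (_⊆_)

open Equivalence using (to; from)

choose : {A : Set} → ℕ → List A → List (List A)
choose zero    xs       = [ [] ]
choose (suc k) []       = []
choose (suc k) (x ∷ xs) = map (x ∷_) (choose k xs) ++ choose (suc k) xs

count : {A : Set} → (A → Bool) → List A → ℕ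
count f ps = sum (map (λ p → if f p then 1 else 0) ps)

module BranchAndBound {A : Set} (_≟_ : DecidableEquality A) (conflictsAt : A → List (List A)) where

  Clash : (A → Bool) → A → Set
  Clash f p = Any (All (T ∘ f)) (conflictsAt p)

  Admissible : (A → Bool) → List A → Set
  Admissible f = All (λ p → ¬ Clash f p)

  CountBound : List A → ℕ → Set
  CountBound ps b = ∀ f → Admissible f ps → count f ps ≤ b

  data SuffixBounds : List A → List ℕ → Set where
    []  : SuffixBounds [] []
    _∷_ : ∀ {p ps b bs} → CountBound (p ∷ ps) b → SuffixBounds ps bs → SuffixBounds (p ∷ ps) (b ∷ bs)

  insert : A → (A → Bool) → A → Bool
  insert p chosen q = isYes (q ≟ p) ∨ chosen q

  clashes : A → (A → Bool) → Bool
  clashes p chosen = any (all (insert p chosen)) (conflictsAt p)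

  mutual
    explore : ℕ → (A → Bool) → List A → List ℕ → Bool
    explore budget chosen []       _        = true
    explore budget chosen (p ∷ ps) []       = false
    explore budget chosen (p ∷ ps) (b ∷ bs) = (b ≤ᵇ budget) ∨ branch budget chosen p ps bs

    branch : ℕ → (A → Bool) → A → List A → List ℕ → Bool
    branch budget chosen p ps bs = explore budget chosen ps bs ∧ (clashes p chosen ∨ fill budget chosen p ps bs)

    fill : ℕ → (A → Bool) → A → List A → List ℕ → Bool
    fill zero         chosen p ps bs = false
    fill (suc budget) chosen p ps bs = explore budget (insert p chosen) ps bs

  certify : List A → List ℕ → Bool
  certify []       []       = true
  certify (p ∷ ps) (b ∷ bs) = branch b (λ _ → false) p ps bs ∧ certify ps bs
  certify _        _        = false

  insert-⊆ : ∀ {p chosen f} → T (f p) → (T ∘ chosen) ⊆ (T ∘ f) → (T ∘ insert p chosen) ⊆ (T ∘ f)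
  insert-⊆ {f = f} fp chosen⊆f t with T-∨ .to t
  ... | inj₁ q≡p = subst (T ∘ f) (sym (toWitness q≡p)) fp
  ... | inj₂ t′  = chosen⊆f t′

  clashes-sound : ∀ {p chosen f} → T (f p) → (T ∘ chosen) ⊆ (T ∘ f) → T (clashes p chosen) → Clash f p
  clashes-sound fp chosen⊆f t =
    Any.map (λ {S} t′ → All.map (insert-⊆ fp chosen⊆f) (all⁺ _ S t′)) (any⁻ _ _ t)

  mutual
    explore-sound : ∀ {budget chosen ps bs f} → SuffixBounds ps bs → T (explore budget chosen ps bs) →
                    (T ∘ chosen) ⊆ (T ∘ f) → Admissible f ps → count f ps ≤ budget
    explore-sound []               _  _        _   = z≤n
    explore-sound {f = f} (bound ∷ bounds) ok chosen⊆f adm with T-∨ .to ok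
    ... | inj₁ b≤budget = ≤-trans (bound f adm) (≤ᵇ⇒≤ _ _ b≤budget)
    ... | inj₂ ok′      = branch-sound bounds ok′ chosen⊆f adm

    branch-sound : ∀ {budget chosen p ps bs f} → SuffixBounds ps bs → T (branch budget chosen p ps bs) →
                   (T ∘ chosen) ⊆ (T ∘ f) → Admissible f (p ∷ ps) → count f (p ∷ ps) ≤ budget
    branch-sound {p = p} {f = f} bounds ok chosen⊆f (no-clash ∷ adm) with f p in fp | T-∧ .to ok
    ... | false | if-empty , _ = explore-sound bounds if-empty chosen⊆f adm
    ... | true  | _ , if-filled with T-∨ .to if-filled
    ...   | inj₁ clash = ⊥-elim (no-clash (clashes-sound (T-≡ .from fp) chosen⊆f clash))
    ...   | inj₂ ok′   = fill-sound bounds ok′ (T-≡ .from fp) chosen⊆f adm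

    fill-sound : ∀ {budget chosen p ps bs f} → SuffixBounds ps bs → T (fill budget chosen p ps bs) →
                 T (f p) → (T ∘ chosen) ⊆ (T ∘ f) → Admissible f ps → suc (count f ps) ≤ budget
    fill-sound {suc budget} bounds ok fp chosen⊆f adm = s≤s (explore-sound bounds ok (insert-⊆ fp chosen⊆f) adm)

  certify-sound : ∀ ps bs → certify ps bs ≡ true → SuffixBounds ps bs
  certify-sound []       []       _  = []
  certify-sound (p ∷ ps) (b ∷ bs) ok = (λ f → branch-sound bounds root (λ ())) ∷ bounds
    where
    ok′ : T (branch b (λ _ → false) p ps bs) × T (certify ps bs)
    ok′ = T-∧ .to (T-≡ .from ok)

    root : T (branch b (λ _ → false) p ps bs)
    root = proj₁ ok′

    bounds : SuffixBounds ps bs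
    bounds = certify-sound ps bs (T-≡ .to (proj₂ ok′))

  head-bound : ∀ {ps b bs} → SuffixBounds ps (b ∷ bs) → CountBound ps b
  head-bound (bound ∷ _) = bound

indicator-mono : ∀ {b c} → (T b → T c) → (if b then 1 else 0) ≤ (if c then 1 else 0)
indicator-mono {false}         _   = z≤n
indicator-mono {true}  {true}  _   = s≤s z≤n
indicator-mono {true}  {false} b⇒c = ⊥-elim (b⇒c _)

sum-map-mono : ∀ {A : Set} {f g : A → ℕ} (xs : List A) → (∀ x → f x ≤ g x) → sum (map f xs) ≤ sum (map g xs)
sum-map-mono []       f≤g = z≤n
sum-map-mono (x ∷ xs) f≤g = +-mono-≤ (f≤g x) (sum-map-mono xs f≤g)

sum-concat : (xss : List (List ℕ)) → sum (concat xss) ≡ sum (map sum xss)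
sum-concat []         = refl
sum-concat (xs ∷ xss) = begin
  sum (xs ++ concat xss)      ≡⟨ sum-++ xs (concat xss) ⟩
  sum xs + sum (concat xss)   ≡⟨ cong (λ s → sum xs + s) (sum-concat xss) ⟩
  sum xs + sum (map sum xss)  ∎
  where open ≡-Reasoning

countCells-mono : ∀ {h w} {P Q : Fin h → Fin w → Bool} → (∀ i j → T (P i j) → T (Q i j)) → countCells P ≤ countCells Q
countCells-mono {h} {w} P⇒Q =
  sum-map-mono (allFin h) λ i → sum-map-mono (allFin w) λ j → indicator-mono (P⇒Q i j)

InW2? : ∀ {h w} (W : Word h w) → Dec (InW2 W)
InW2? W = all? λ i → all? λ j → (W i j Bool.≟ true) →-dec (degree W i j ℕ.≤? 2)

module _ {h w : ℕ} where

  open DecMembership (≡-dec (Fin._≟_ {h}) (Fin._≟_ {w})) using (_∈?_)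

  -- Counting the cells that occur among the leaves, rather than taking the length of the list,
  -- makes the three leaves distinct.
  isClaw : Fin h × Fin w → List (Fin h × Fin w) → Bool
  isClaw (i , j) leaves =
    (3 ≤ᵇ countCells (λ i′ j′ → isYes ((i′ , j′) ∈? leaves))) ∧ all (uncurry (adjacent i j)) leaves

  filled-claw⇒¬InW2 : (W : Word h w) {i : Fin h} {j : Fin w} {leaves : List (Fin h × Fin w)} →
                      T (isClaw (i , j) leaves) → T (W i j) → All (T ∘ uncurry W) leaves → ¬ InW2 W
  filled-claw⇒¬InW2 W {i} {j} {leaves} claw filled leaves-filled inW2 = ℕ.<-irrefl refl (begin
    3                                                      ≤⟨ ≤ᵇ⇒≤ 3 _ (proj₁ (T-∧ .to claw)) ⟩
    countCells (λ i′ j′ → isYes ((i′ , j′) ∈? leaves))    ≤⟨ countCells-mono leaf⇒filled-neighbour ⟩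
    degree W i j                                           ≤⟨ inW2 i j (T-≡ .to filled) ⟩
    2                                                      ∎)
    where
    open ℕ.≤-Reasoning
    leaf⇒filled-neighbour : ∀ i′ j′ → T (isYes ((i′ , j′) ∈? leaves)) → T (W i′ j′ ∧ adjacent i j i′ j′)
    leaf⇒filled-neighbour i′ j′ t =
      All.lookup (All.zipWith (T-∧ .from) (leaves-filled , all⁺ _ leaves (proj₂ (T-∧ .to claw)))) (toWitness t)

module RowMajor (h w : ℕ) .{{_ : NonZero h}} .{{_ : NonZero w}} where

  -- The outer mod h only makes the row land in Fin h; it is the identity on positions below h * w.
  cellOf : ℕ → Fin h × Fin w
  cellOf p = (p div w) mod h , p mod w

  linearise : Word h w → ℕ → Bool
  linearise W = uncurry W ∘ cellOf

  neighbours : ℕ → List ℕ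
  neighbours p =
       (if w ≤ᵇ p             then [ p ∸ w ] else [])
    ++ (if 0 <ᵇ p % w         then [ p ∸ 1 ] else [])
    ++ (if suc (p % w) <ᵇ w   then [ suc p ] else [])
    ++ (if p + w <ᵇ h * w     then [ p + w ] else [])

  -- Listing each claw under its largest position lets the search detect it as soon as it is fully
  -- decided; soundness only needs every listed conflict to be a claw.
  clawsEndingAt : ℕ → List (List ℕ)
  clawsEndingAt q =
    concatMap (λ c → map (λ leaves → c ∷ q ∷ leaves) (choose 2 (before (neighbours c)))) (before (neighbours q))
    where
    before : List ℕ → List ℕ
    before = filter (ℕ._<? q)

  isLinearClaw : List ℕ → Bool
  isLinearClaw []           = false
  isLinearClaw (c ∷ leaves) = isClaw (cellOf c) (map cellOf leaves)

  open BranchAndBound ℕ._≟_ clawsEndingAt public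

  module _ {W : Word h w} (inW2 : InW2 W) where

    InW2⇒¬filled-claw : ∀ {S} → T (isLinearClaw S) → ¬ All (T ∘ linearise W) S
    InW2⇒¬filled-claw {c ∷ leaves} claw (filled ∷ leaves-filled) =
      filled-claw⇒¬InW2 W claw filled (map⁺ leaves-filled) inW2

    InW2⇒admissible : ∀ ps → all (all isLinearClaw ∘ clawsEndingAt) ps ≡ true → Admissible (linearise W) ps
    InW2⇒admissible ps valid = All.map no-clash (all⁺ _ ps (T-≡ .from valid))
      where
      no-clash : ∀ {q} → T (all isLinearClaw (clawsEndingAt q)) → ¬ Clash (linearise W) q
      no-clash valid-q clash = uncurry InW2⇒¬filled-claw (All.lookupAny (all⁺ _ _ valid-q) clash)

open RowMajor 7 7

claws-valid : all (all isLinearClaw ∘ clawsEndingAt) (upTo 49) ≡ true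
claws-valid = refl

suffixBounds : List ℕ
suffixBounds =
  34 ∷ 34 ∷ 33 ∷ 32 ∷ 32 ∷ 31 ∷ 30 ∷ 29 ∷ 29 ∷ 28 ∷ 27 ∷ 27 ∷ 26 ∷ 25 ∷ 24 ∷ 24 ∷ 23 ∷ 23 ∷ 22 ∷ 21 ∷ 21 ∷ 20 ∷ 20 ∷ 19 ∷ 18 ∷
  18 ∷ 17 ∷ 16 ∷ 16 ∷ 15 ∷ 14 ∷ 14 ∷ 13 ∷ 13 ∷ 12 ∷ 11 ∷ 10 ∷ 10 ∷ 9 ∷ 9 ∷ 8 ∷ 8 ∷ 7 ∷ 6 ∷ 5 ∷ 4 ∷ 3 ∷ 2 ∷ 1 ∷ []

suffixBounds-sound : SuffixBounds (upTo 49) suffixBounds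
suffixBounds-sound = certify-sound (upTo 49) suffixBounds refl

count-linearise : (W : Word 7 7) → count (linearise W) (upTo 49) ≡ filledCount W
count-linearise W = sum-concat (map (λ i → map (λ j → if W i j then 1 else 0) (allFin 7)) (allFin 7))

filledCount≤34 : (W : Word 7 7) → InW2 W → filledCount W ≤ 34
filledCount≤34 W inW2 = subst (_≤ 34) (count-linearise W)
  (head-bound suffixBounds-sound (linearise W)
    (InW2⇒admissible inW2 (upTo 49) claws-valid))

pattern ■ = true
pattern □ = false

witness : Word 7 7
witness i j = Vec.lookup (Vec.lookup rows i) j
  where
  rows : Vec (Vec Bool 7) 7
  rows = (■ ∷ ■ ∷ ■ ∷ ■ ∷ □ ∷ ■ ∷ ■ ∷ [])
       ∷ (■ ∷ □ ∷ □ ∷ ■ ∷ ■ ∷ □ ∷ ■ ∷ [])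
       ∷ (■ ∷ ■ ∷ ■ ∷ □ ∷ ■ ∷ ■ ∷ □ ∷ [])
       ∷ (□ ∷ □ ∷ ■ ∷ ■ ∷ □ ∷ ■ ∷ ■ ∷ [])
       ∷ (■ ∷ ■ ∷ □ ∷ ■ ∷ ■ ∷ □ ∷ ■ ∷ [])
       ∷ (■ ∷ □ ∷ ■ ∷ □ ∷ ■ ∷ □ ∷ ■ ∷ [])
       ∷ (■ ∷ ■ ∷ ■ ∷ □ ∷ ■ ∷ ■ ∷ ■ ∷ [])
       ∷ []

witness-InW2 : InW2 witness
witness-InW2 = toWitness {a? = InW2? witness} _

/1-mono-≤ : ∀ {m n} → m ≤ n → + m / 1 ≤ℚ + n / 1
/1-mono-≤ {m} {n} m≤n
  rewrite ℚ.normalize-coprime {m} {0} (Coprimality.sym (Coprimality.1-coprimeTo m))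
        | ℚ.normalize-coprime {n} {0} (Coprimality.sym (Coprimality.1-coprimeTo n))
  = *≤* (subst₂ ℤ._≤_ (sym (ℤ.*-identityʳ (+ m))) (sym (ℤ.*-identityʳ (+ n))) (ℤ.+≤+ m≤n))

excess-mono : ∀ {h w} (W : Word h w) {m} → filledCount W ≤ m → excess W ≤ℚ + m / 1 - + (2 * h * w) / 3
excess-mono {h} {w} W W≤m = ℚ.+-monoˡ-≤ (- (+ (2 * h * w) / 3)) (/1-mono-≤ W≤m)

proposition10 : EmaxIs 7 7 (+ 4 / 3)
proposition10 = (witness , witness-InW2 , refl) , λ W inW2 → excess-mono W (filledCount≤34 W inW2)
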